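{- For all $g\ge1$ and $1\le t\le g$, the number $\kappa_{g,t}$ is a positive integer.
   Context: For $g\ge1$ and $1\le t\le g$, \[ \kappa_{g,t}=\frac{(2(2g+t-1))!}{2^{2g}(2g+t-1)!}\sum_{\substack{\gamma\vdash g\\ \ell(\gamma)=t}}\frac{1}{\prod_i m_i!(2i+1)^{m_i}}, \] the sum being over partitions $\gamma=1^{m_1}2^{m_2}\cdots j^{m_j}$ of $g$ with exactly $t$ parts. -}

module Defs where

open import Data.Nat as ℕ using (ℕ; zero; suc; _∸_; _!; _≡ᵇ_)
open import Data.Nat.Properties using (_!≢0)
open import Data.Integer using (+_)
open import Data.Rational using (ℚ; _/_; 0ℚ; 1ℚ; _+_; _*_)
open import Data.Vec using (Vec; []; _∷_)
open import Data.List using (List; []; _∷_; map; concatMap; upTo; filterᵇ)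
open import Data.Bool using (_∧_)

_^ℚ_ : ℚ → ℕ → ℚ
q ^ℚ zero  = 1ℚ
q ^ℚ suc n = q * (q ^ℚ n)

-- A partition γ = 1^{m_1} 2^{m_2} ⋯ g^{m_g} of (a number ≤) g is represented by its
-- multiplicity vector (m_1 , … , m_g).  Each m_i ≤ g necessarily.
-- allVecs n b : all vectors in {0,…,b}^n.
allVecs : (n b : ℕ) → List (Vec ℕ n)
allVecs zero    b = [] ∷ []
allVecs (suc n) b = concatMap (λ m → map (m ∷_) (allVecs n b)) (upTo (suc b))

sizeFrom : ℕ → {n : ℕ} → Vec ℕ n → ℕ
sizeFrom i []       = 0
sizeFrom i (m ∷ ms) = i ℕ.* m ℕ.+ sizeFrom (suc i) ms

lengthP : {n : ℕ} → Vec ℕ n → ℕ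
lengthP []       = 0
lengthP (m ∷ ms) = m ℕ.+ lengthP ms

partitionsWithParts : (g t : ℕ) → List (Vec ℕ g)
partitionsWithParts g t =
  filterᵇ (λ m → (sizeFrom 1 m ≡ᵇ g) ∧ (lengthP m ≡ᵇ t)) (allVecs g g)

weightFrom : ℕ → {n : ℕ} → Vec ℕ n → ℚ
weightFrom i []       = 1ℚ
weightFrom i (m ∷ ms) =
  ((+ 1 / (m !)) {{m !≢0}} * ((+ 1 / suc (2 ℕ.* i)) ^ℚ m)) * weightFrom (suc i) ms

sumℚ : List ℚ → ℚ
sumℚ []       = 0ℚ
sumℚ (x ∷ xs) = x + sumℚ xs

κ : ℕ → ℕ → ℚ
κ g t =
  ((+ ((2 ℕ.* N) !) / (N !)) {{N !≢0}} * ((+ 1 / 4) ^ℚ g))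
  * sumℚ (map (weightFrom 1) (partitionsWithParts g t))
  where
  N : ℕ
  N = 2 ℕ.* g ℕ.+ t ∸ 1

-- Write N = 2g + t - 1.  Since (2N)! = 2^N N! (2N-1)!!, the prefactor of κ_{g,t} is the
-- integer A = 2^(t-1) (2N-1)!!, and it suffices that every denominator ∏ m_i! (2i+1)^{m_i}
-- with Σ m_i (2i+1) = N + 1 divides A.  Cut the odd numbers 1, 3, …, 2N-1 into consecutive
-- blocks of m_i (2i+1) numbers, one block per part size (the first block one number
-- shorter).  A block of m (2i+1) consecutive odd numbers contains m odd multiples
-- (2i+1)(2b+1), (2i+1)(2b+3), …, whose product (2i+1)^m (2b+1)(2b+3)⋯(2b+2m-1) is, after
-- multiplying by 2^m, divisible by (2i+1)^m m!.

module Submission where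

open import Defs
open import Data.Nat using (ℕ; _≤_)
open import Data.Integer using (+_)
open import Data.Rational using (_/_)
open import Data.Product using (∃-syntax; _×_)
open import Relation.Binary.PropositionalEquality using (_≡_)

open import Data.Bool using (Bool; T; _∧_)
open import Data.Bool.Properties using (T-∧)
open import Data.Fin using (Fin; zero; suc; toℕ; fromℕ<)
open import Data.Fin.Properties using (toℕ-fromℕ<)
import Data.Integer as ℤ
import Data.Integer.Properties as ℤ
open import Data.List using ([]; _∷_; map)
open import Data.List.Membership.Propositional using (_∈_)
open import Data.List.Membership.Propositional.Properties
  using (∈-map⁺; ∈-concat⁺′; ∈-upTo⁺; ∈-filter⁺)
open import Data.List.Properties using (map-cong-local)
import Data.List.Relation.Unary.All as List
open import Data.List.Relation.Unary.All.Properties using (all-filter)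
open import Data.List.Relation.Unary.Any using (here; there)
open import Data.Nat as ℕ hiding (_/_)
open import Data.Nat.Combinatorics using (k![n∸k]!∣n!)
open import Data.Nat.Divisibility
open import Data.Nat.DivMod using (m/n*n≡m; m≥n⇒m/n>0)
open import Data.Nat.ListAction using (sum)
open import Data.Nat.Properties
open import Data.Nat.Tactic.RingSolver using (solve-∀)
open import Data.Product using (∃₂; _,_)
open import Data.Rational as ℚ using (ℚ)
open import Data.Rational.Properties
  using (toℚᵘ-injective; toℚᵘ-fromℚᵘ; toℚᵘ-homo-*; toℚᵘ-homo-+; /-cong; fromℚᵘ-cong)
  renaming (*-distribˡ-+ to ℚ-*-distribˡ-+; *-zeroʳ to ℚ-*-zeroʳ)
open import Data.Rational.Unnormalised as ℚᵘ using (mkℚᵘ; *≡*)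
import Data.Rational.Unnormalised.Properties as ℚᵘ
open import Data.Vec using (Vec; []; _∷_; replicate)
import Data.Vec.Relation.Unary.All as Vec
open import Function using (_∘_)
open import Function.Bundles using (module Equivalence)
open import Relation.Binary.PropositionalEquality
  using (refl; sym; trans; cong; cong₂; subst; module ≡-Reasoning)
open import Relation.Nullary.Decidable.Core using (T?)

private variable n : ℕ

oddProduct : ℕ → ℕ → ℕ
oddProduct b zero    = 1
oddProduct b (suc m) = suc (2 * b) * oddProduct (suc b) m

oddProduct≢0 : ∀ b m → NonZero (oddProduct b m)
oddProduct≢0 b zero    = _
oddProduct≢0 b (suc m) = m*n≢0 (suc (2 * b)) _ {{_}} {{oddProduct≢0 (suc b) m}}

oddProduct-+ : ∀ b m n → oddProduct b (m + n) ≡ oddProduct b m * oddProduct (b + m) n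
oddProduct-+ b zero    n = sym (trans (+-identityʳ _) (cong (λ c → oddProduct c n) (+-identityʳ b)))
oddProduct-+ b (suc m) n = begin
  suc (2 * b) * oddProduct (suc b) (m + n)                   ≡⟨ cong (suc (2 * b) *_) (oddProduct-+ (suc b) m n) ⟩
  suc (2 * b) * (oddProduct (suc b) m * oddProduct (suc b + m) n) ≡⟨ *-assoc (suc (2 * b)) (oddProduct (suc b) m) (oddProduct (suc b + m) n) ⟨
  suc (2 * b) * oddProduct (suc b) m * oddProduct (suc b + m) n   ≡⟨ cong (λ c → suc (2 * b) * oddProduct (suc b) m * oddProduct c n) (+-suc b m) ⟨
  suc (2 * b) * oddProduct (suc b) m * oddProduct (b + suc m) n   ∎
  where open ≡-Reasoning

oddProduct-suc : ∀ b m → oddProduct b (suc m) ≡ oddProduct b m * suc (2 * (b + m))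
oddProduct-suc b m = begin
  oddProduct b (suc m)                     ≡⟨ cong (oddProduct b) (+-comm 1 m) ⟩
  oddProduct b (m + 1)                     ≡⟨ oddProduct-+ b m 1 ⟩
  oddProduct b m * (suc (2 * (b + m)) * 1) ≡⟨ cong (oddProduct b m *_) (*-identityʳ _) ⟩
  oddProduct b m * suc (2 * (b + m))       ∎
  where open ≡-Reasoning

oddProduct-infix-∣ : ∀ b a m l → a + m ≤ l → oddProduct (b + a) m ∣ oddProduct b l
oddProduct-infix-∣ b a m l a+m≤l with r , refl ← m≤n⇒∃[o]m+o≡n a+m≤l = begin
  oddProduct (b + a) m                                      ∣⟨ n∣m*n (oddProduct b a) ⟩
  oddProduct b a * oddProduct (b + a) m                     ≡⟨ oddProduct-+ b a m ⟨
  oddProduct b (a + m)                                      ∣⟨ m∣m*n (oddProduct (b + (a + m)) r) ⟩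
  oddProduct b (a + m) * oddProduct (b + (a + m)) r         ≡⟨ oddProduct-+ b (a + m) r ⟨
  oddProduct b (a + m + r)                                  ∎
  where open ∣-Reasoning

2^*oddProduct-+ : ∀ a c b x y →
  (2 ^ a * oddProduct b x) * (2 ^ c * oddProduct (b + x) y) ≡ 2 ^ (a + c) * oddProduct b (x + y)
2^*oddProduct-+ a c b x y = begin
  (2 ^ a * oddProduct b x) * (2 ^ c * oddProduct (b + x) y) ≡⟨ interchange (2 ^ a) _ (2 ^ c) _ ⟩
  (2 ^ a * 2 ^ c) * (oddProduct b x * oddProduct (b + x) y) ≡⟨ cong₂ _*_ (^-distribˡ-+-* 2 a c) (oddProduct-+ b x y) ⟨
  2 ^ (a + c) * oddProduct b (x + y)                        ∎
  where
  open ≡-Reasoning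
  interchange : ∀ p q r s → (p * q) * (r * s) ≡ (p * r) * (q * s)
  interchange = solve-∀

[2m+1]!≡m!*2^m*oddProduct : ∀ m → suc (2 * m) ! ≡ m ! * (2 ^ m * oddProduct 0 (suc m))
[2m+1]!≡m!*2^m*oddProduct zero    = refl
[2m+1]!≡m!*2^m*oddProduct (suc m) = begin
  suc (2 * suc m) !                                                      ≡⟨ cong (λ k → suc k !) (*-suc 2 m) ⟩
  suc (suc (suc (2 * m))) * (suc (suc (2 * m)) * suc (2 * m) !)          ≡⟨ cong (λ k → suc (suc (suc (2 * m))) * (suc (suc (2 * m)) * k)) ([2m+1]!≡m!*2^m*oddProduct m) ⟩
  suc (suc (suc (2 * m))) * (suc (suc (2 * m)) * (m ! * (2 ^ m * P)))    ≡⟨ rearrange m (m !) (2 ^ m) P ⟩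
  suc m ! * (2 ^ suc m * (P * suc (2 * suc m)))                          ≡⟨ cong (λ k → suc m ! * (2 ^ suc m * k)) (oddProduct-suc 0 (suc m)) ⟨
  suc m ! * (2 ^ suc m * oddProduct 0 (suc (suc m)))                     ∎
  where
  open ≡-Reasoning
  P = oddProduct 0 (suc m)
  rearrange : ∀ m f p q → suc (suc (suc (2 * m))) * (suc (suc (2 * m)) * (f * (p * q)))
                        ≡ suc m * f * (2 * p * (q * suc (2 * suc m)))
  rearrange = solve-∀

[2m]!≡m!*2^m*oddProduct : ∀ m → (2 * m) ! ≡ m ! * (2 ^ m * oddProduct 0 m)
[2m]!≡m!*2^m*oddProduct zero    = refl
[2m]!≡m!*2^m*oddProduct (suc m) = begin
  (2 * suc m) !                                               ≡⟨ cong _! (*-suc 2 m) ⟩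
  suc (suc (2 * m)) * suc (2 * m) !                           ≡⟨ cong (suc (suc (2 * m)) *_) ([2m+1]!≡m!*2^m*oddProduct m) ⟩
  suc (suc (2 * m)) * (m ! * (2 ^ m * oddProduct 0 (suc m)))  ≡⟨ rearrange m (m !) (2 ^ m) _ ⟩
  suc m ! * (2 ^ suc m * oddProduct 0 (suc m))                ∎
  where
  open ≡-Reasoning
  rearrange : ∀ m f p q → suc (suc (2 * m)) * (f * (p * q)) ≡ suc m * f * (2 * p * q)
  rearrange = solve-∀

-- For b = 0 this is m!·m! ∣ (2m)!; for b > 0, with P = oddProduct, use the Pascal-like
-- recursion 2^(m+1) P(b+1,m+1) = 2^(m+1) P(b,m+1) + (m+1)·4·2^m P(b+1,m).
m!∣2^m*oddProduct : ∀ b m → m ! ∣ 2 ^ m * oddProduct b m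
m!∣2^m*oddProduct b       zero    = 1∣ _
m!∣2^m*oddProduct zero    (suc m) = *-cancelˡ-∣ (suc m !) (begin
  suc m ! * suc m !                                 ≡⟨ cong (λ k → suc m ! * k !) (trans (m+n∸m≡n (suc m) (suc m + 0)) (+-identityʳ (suc m))) ⟨
  suc m ! * (2 * suc m ∸ suc m) !                   ∣⟨ k![n∸k]!∣n! (m≤m+n (suc m) (suc m + 0)) ⟩
  (2 * suc m) !                                     ≡⟨ [2m]!≡m!*2^m*oddProduct (suc m) ⟩
  suc m ! * (2 ^ suc m * oddProduct 0 (suc m))      ∎)
  where
  open ∣-Reasoning
  instance _ = suc m !≢0
m!∣2^m*oddProduct (suc b) (suc m) = begin
  suc m * m !                                                        ∣⟨ ∣m∣n⇒∣m+n (m!∣2^m*oddProduct b (suc m))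
                                                                         (*-monoʳ-∣ (suc m) (∣-trans (m!∣2^m*oddProduct (suc b) m) (n∣m*n 4))) ⟩
  2 ^ suc m * (suc (2 * b) * Q) + suc m * (4 * (2 ^ m * Q))          ≡⟨ recursion b m (2 ^ m) Q ⟨
  2 ^ suc m * (Q * suc (2 * (suc b + m)))                            ≡⟨ cong (2 ^ suc m *_) (oddProduct-suc (suc b) m) ⟨
  2 ^ suc m * oddProduct (suc b) (suc m)                             ∎
  where
  open ∣-Reasoning
  Q = oddProduct (suc b) m
  recursion : ∀ b m p q → 2 * p * (q * suc (2 * (suc b + m))) ≡ 2 * p * (suc (2 * b) * q) + suc m * (4 * (p * q))
  recursion = solve-∀

[1+m]!∣2^m*oddProduct : ∀ m → suc m ! ∣ 2 ^ m * oddProduct 0 (suc m)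
[1+m]!∣2^m*oddProduct m = *-cancelˡ-∣ (m !) (begin
  m ! * suc m !                                ≡⟨ cong (λ k → m ! * k !) (m+n∸m≡n m (suc m)) ⟨
  m ! * (m + suc m ∸ m) !                      ∣⟨ k![n∸k]!∣n! (m≤m+n m (suc m)) ⟩
  (m + suc m) !                                ≡⟨ cong _! (trans (+-suc m m) (cong (λ k → suc (m + k)) (sym (+-identityʳ m)))) ⟩
  suc (2 * m) !                                ≡⟨ [2m+1]!≡m!*2^m*oddProduct m ⟩
  m ! * (2 ^ m * oddProduct 0 (suc m))         ∎)
  where
  open ∣-Reasoning
  instance _ = m !≢0

odd-multiple-within : ∀ i n → ∃₂ λ gap b → gap ≤ 2 * i × suc (2 * (n + gap)) ≡ suc (2 * i) * suc (2 * b)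
odd-multiple-within i zero = i , 0 , m≤m+n i (i + 0) , sym (*-identityʳ _)
odd-multiple-within i (suc n) with odd-multiple-within i n
... | suc gap , b , gap≤2i , eq =
  gap , b , ≤-trans (n≤1+n gap) gap≤2i , trans (cong (λ k → suc (2 * k)) (sym (+-suc n gap))) eq
... | zero , b , _ , eq = 2 * i , suc b , ≤-refl , (begin
  suc (2 * (suc n + 2 * i))                     ≡⟨ shift n i ⟩
  suc (2 * (n + 0)) + 2 * suc (2 * i)           ≡⟨ cong (_+ 2 * suc (2 * i)) eq ⟩
  suc (2 * i) * suc (2 * b) + 2 * suc (2 * i)   ≡⟨ next i b ⟩
  suc (2 * i) * suc (2 * suc b)                 ∎)
  where
  open ≡-Reasoning
  shift : ∀ n i → suc (2 * (suc n + 2 * i)) ≡ suc (2 * (n + 0)) + 2 * suc (2 * i)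
  shift = solve-∀
  next : ∀ i b → suc (2 * i) * suc (2 * b) + 2 * suc (2 * i) ≡ suc (2 * i) * suc (2 * suc b)
  next = solve-∀

-- If 2n+1 = s(2b+1), then the odd numbers 2n+1 + 2js (j ≤ m) are s(2b+1), s(2b+3), …
oddProduct-multiples-∣ : ∀ i n b → suc (2 * n) ≡ suc (2 * i) * suc (2 * b) → ∀ m →
  suc (2 * i) ^ suc m * oddProduct b (suc m) ∣ oddProduct n (suc (m * suc (2 * i)))
oddProduct-multiples-∣ i n b eq zero = ∣-reflexive (begin
  (s * 1) * (suc (2 * b) * 1)  ≡⟨ cong₂ _*_ (*-identityʳ s) (*-identityʳ (suc (2 * b))) ⟩
  s * suc (2 * b)              ≡⟨ eq ⟨
  suc (2 * n)                  ≡⟨ *-identityʳ (suc (2 * n)) ⟨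
  suc (2 * n) * 1              ∎)
  where
  open ≡-Reasoning
  s = suc (2 * i)
oddProduct-multiples-∣ i n b eq (suc m) = begin
  s ^ suc (suc m) * oddProduct b (suc (suc m))
    ≡⟨ cong (s ^ suc (suc m) *_) (oddProduct-suc b (suc m)) ⟩
  s * s ^ suc m * (oddProduct b (suc m) * suc (2 * (b + suc m)))
    ≡⟨ interchange s (s ^ suc m) (oddProduct b (suc m)) _ ⟩
  s ^ suc m * oddProduct b (suc m) * (s * suc (2 * (b + suc m)))
    ∣⟨ *-pres-∣ (oddProduct-multiples-∣ i n b eq m) next-multiple-∣ ⟩
  oddProduct n (suc (m * s)) * oddProduct x s
    ≡⟨ oddProduct-+ n (suc (m * s)) s ⟨
  oddProduct n (suc (m * s) + s)
    ≡⟨ cong (λ k → oddProduct n (suc k)) (+-comm (m * s) s) ⟩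
  oddProduct n (suc (suc m * s))
    ∎
  where
  open ∣-Reasoning
  s = suc (2 * i)
  x = n + suc (m * s)
  interchange : ∀ p q r u → p * q * (r * u) ≡ q * r * (p * u)
  interchange = solve-∀
  shift : ∀ n i m → suc (2 * (n + suc (m * suc (2 * i)) + 2 * i)) ≡ suc (2 * n) + 2 * (suc m * suc (2 * i))
  shift = solve-∀
  next : ∀ i b m → suc (2 * i) * suc (2 * b) + 2 * (suc m * suc (2 * i)) ≡ suc (2 * i) * suc (2 * (b + suc m))
  next = solve-∀
  next-multiple-∣ : s * suc (2 * (b + suc m)) ∣ oddProduct x s
  next-multiple-∣ = begin
    s * suc (2 * (b + suc m))                     ≡⟨ next i b m ⟨
    s * suc (2 * b) + 2 * (suc m * s)             ≡⟨ cong (_+ 2 * (suc m * s)) eq ⟨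
    suc (2 * n) + 2 * (suc m * s)                 ≡⟨ shift n i m ⟨
    suc (2 * (x + 2 * i))                         ∣⟨ n∣m*n (oddProduct x (2 * i)) ⟩
    oddProduct x (2 * i) * suc (2 * (x + 2 * i))  ≡⟨ oddProduct-suc x (2 * i) ⟨
    oddProduct x s                                ∎

a∣c*q⇒s*q∣l⇒a*s∣c*l : ∀ {a c q s l} → a ∣ c * q → s * q ∣ l → a * s ∣ c * l
a∣c*q⇒s*q∣l⇒a*s∣c*l {a} {c} {q} {s} {l} a∣c*q s*q∣l = begin
  a * s        ∣⟨ *-monoˡ-∣ s a∣c*q ⟩
  c * q * s    ≡⟨ trans (*-assoc c q s) (cong (c *_) (*-comm q s)) ⟩
  c * (s * q)  ∣⟨ *-monoʳ-∣ c s*q∣l ⟩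
  c * l        ∎
  where open ∣-Reasoning

block-∣ : ∀ i n m → m ! * suc (2 * i) ^ m ∣ 2 ^ m * oddProduct n (m * suc (2 * i))
block-∣ i n zero    = 1∣ _
block-∣ i n (suc k) with gap , b , gap≤2i , eq ← odd-multiple-within i n =
  a∣c*q⇒s*q∣l⇒a*s∣c*l {c = 2 ^ suc k} (m!∣2^m*oddProduct b (suc k)) (begin
    s ^ suc k * oddProduct b (suc k)  ∣⟨ oddProduct-multiples-∣ i (n + gap) b eq k ⟩
    oddProduct (n + gap) (suc (k * s)) ∣⟨ oddProduct-infix-∣ n gap (suc (k * s)) (suc k * s) fits ⟩
    oddProduct n (suc k * s)           ∎)
  where
  open ∣-Reasoning
  s = suc (2 * i)
  fits : gap + suc (k * s) ≤ suc k * s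
  fits = subst (_≤ suc k * s) (sym (+-suc gap (k * s))) (s≤s (+-monoˡ-≤ (k * s) gap≤2i))

first-block-∣ : ∀ i → 1 ≤ i → ∀ k → suc k ! * suc (2 * i) ^ suc k ∣ 2 ^ k * oddProduct 0 (2 * i + k * suc (2 * i))
first-block-∣ i@(suc j) _ k =
  a∣c*q⇒s*q∣l⇒a*s∣c*l {c = 2 ^ k} ([1+m]!∣2^m*oddProduct k) (begin
    s ^ suc k * oddProduct 0 (suc k)  ∣⟨ oddProduct-multiples-∣ i i 0 (sym (*-identityʳ s)) k ⟩
    oddProduct i (suc (k * s))        ∣⟨ oddProduct-infix-∣ 0 i (suc (k * s)) (2 * i + k * s) fits ⟩
    oddProduct 0 (2 * i + k * s)      ∎)
  where
  open ∣-Reasoning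
  s = suc (2 * i)
  slack : ∀ j x → suc j + suc x + j ≡ 2 * suc j + x
  slack = solve-∀
  fits : i + suc (k * s) ≤ 2 * i + k * s
  fits = subst (i + suc (k * s) ≤_) (slack j (k * s)) (m≤m+n (i + suc (k * s)) j)

denominator : ℕ → Vec ℕ n → ℕ
denominator i []       = 1
denominator i (m ∷ ms) = m ! * suc (2 * i) ^ m * denominator (suc i) ms

denominator≢0 : ∀ i (v : Vec ℕ n) → NonZero (denominator i v)
denominator≢0 i []       = _
denominator≢0 i (m ∷ ms) = m*n≢0 (m ! * suc (2 * i) ^ m) (denominator (suc i) ms)
  where instance
  _ = m !≢0
  _ = m^n≢0 (suc (2 * i)) m
  _ = m*n≢0 (m !) (suc (2 * i) ^ m)
  _ = denominator≢0 (suc i) ms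

oddSize : ℕ → Vec ℕ n → ℕ
oddSize i []       = 0
oddSize i (m ∷ ms) = m * suc (2 * i) + oddSize (suc i) ms

oddSize≡2*sizeFrom+lengthP : ∀ i (v : Vec ℕ n) → oddSize i v ≡ 2 * sizeFrom i v + lengthP v
oddSize≡2*sizeFrom+lengthP i []       = refl
oddSize≡2*sizeFrom+lengthP i (m ∷ ms) = begin
  m * suc (2 * i) + oddSize (suc i) ms                                   ≡⟨ cong (_+_ (m * suc (2 * i))) (oddSize≡2*sizeFrom+lengthP (suc i) ms) ⟩
  m * suc (2 * i) + (2 * sizeFrom (suc i) ms + lengthP ms)               ≡⟨ regroup i m (sizeFrom (suc i) ms) (lengthP ms) ⟩
  2 * (i * m + sizeFrom (suc i) ms) + (m + lengthP ms)                   ∎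
  where
  open ≡-Reasoning
  regroup : ∀ i m x y → m * suc (2 * i) + (2 * x + y) ≡ 2 * (i * m + x) + (m + y)
  regroup = solve-∀

denominator-∣ : ∀ i b (v : Vec ℕ n) → denominator i v ∣ 2 ^ lengthP v * oddProduct b (oddSize i v)
denominator-∣ i b []       = 1∣ _
denominator-∣ i b (m ∷ ms) = begin
  m ! * s ^ m * denominator (suc i) ms
    ∣⟨ *-pres-∣ (block-∣ i b m) (denominator-∣ (suc i) (b + m * s) ms) ⟩
  2 ^ m * oddProduct b (m * s) * (2 ^ lengthP ms * oddProduct (b + m * s) (oddSize (suc i) ms))
    ≡⟨ 2^*oddProduct-+ m (lengthP ms) b (m * s) (oddSize (suc i) ms) ⟩
  2 ^ (m + lengthP ms) * oddProduct b (m * s + oddSize (suc i) ms)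
    ∎
  where
  open ∣-Reasoning
  s = suc (2 * i)

-- The block of the smallest part is one odd number shorter, which costs one factor 2.
denominator-∣-initial : ∀ i → 1 ≤ i → (v : Vec ℕ n) → 1 ≤ lengthP v →
  denominator i v ∣ 2 ^ (lengthP v ∸ 1) * oddProduct 0 (oddSize i v ∸ 1)
denominator-∣-initial i 1≤i (zero ∷ ms)  ℓ≥1 =
  ∣-trans (∣-reflexive (*-identityˡ _)) (denominator-∣-initial (suc i) (m≤n⇒m≤1+n 1≤i) ms ℓ≥1)
denominator-∣-initial i 1≤i (suc k ∷ ms) _   = begin
  suc k ! * s ^ suc k * denominator (suc i) ms
    ∣⟨ *-pres-∣ (first-block-∣ i 1≤i k) (denominator-∣ (suc i) (2 * i + k * s) ms) ⟩
  2 ^ k * oddProduct 0 (2 * i + k * s) * (2 ^ lengthP ms * oddProduct (2 * i + k * s) (oddSize (suc i) ms))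
    ≡⟨ 2^*oddProduct-+ k (lengthP ms) 0 (2 * i + k * s) (oddSize (suc i) ms) ⟩
  2 ^ (k + lengthP ms) * oddProduct 0 (2 * i + k * s + oddSize (suc i) ms)
    ∎
  where
  open ∣-Reasoning
  s = suc (2 * i)

entries≤sizeFrom : ∀ i (v : Vec ℕ n) → Vec.All (_≤ sizeFrom (suc i) v) v
entries≤sizeFrom i []       = Vec.[]
entries≤sizeFrom i (m ∷ ms) =
  ≤-trans (m≤m+n m (i * m)) (m≤m+n _ _) Vec.∷
  Vec.map (λ ≤size → ≤-trans ≤size (m≤n+m _ (suc i * m))) (entries≤sizeFrom (suc i) ms)

∈-allVecs : ∀ b (v : Vec ℕ n) → Vec.All (_≤ b) v → v ∈ allVecs n b
∈-allVecs b []       Vec.[]             = here refl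
∈-allVecs b (m ∷ ms) (m≤b Vec.∷ ms≤b) =
  ∈-concat⁺′ (∈-map⁺ (m ∷_) (∈-allVecs b ms ms≤b))
             (∈-map⁺ (λ k → map (k ∷_) (allVecs _ b)) (∈-upTo⁺ (s≤s m≤b)))

IsPartition : (g t : ℕ) → Vec ℕ g → Set
IsPartition g t v = sizeFrom 1 v ≡ g × lengthP v ≡ t

-- Must coincide with the filter in partitionsWithParts.
isPartitionᵇ : (g t : ℕ) → Vec ℕ g → Bool
isPartitionᵇ g t v = (sizeFrom 1 v ≡ᵇ g) ∧ (lengthP v ≡ᵇ t)

∈-partitionsWithParts⁺ : ∀ {g t} (v : Vec ℕ g) → IsPartition g t v → v ∈ partitionsWithParts g t
∈-partitionsWithParts⁺ {g} {t} v (size≡g , length≡t) =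
  ∈-filter⁺ (T? ∘ isPartitionᵇ g t) (∈-allVecs g v (subst (λ b → Vec.All (_≤ b) v) size≡g (entries≤sizeFrom 0 v)))
    (Equivalence.from T-∧ (≡⇒≡ᵇ _ _ size≡g , ≡⇒≡ᵇ _ _ length≡t))

partitionsWithParts-sound : ∀ g t → List.All (IsPartition g t) (partitionsWithParts g t)
partitionsWithParts-sound g t = List.map (λ {v} → sound v) (all-filter (T? ∘ isPartitionᵇ g t) (allVecs g g))
  where
  sound : ∀ v → T (isPartitionᵇ g t v) → IsPartition g t v
  sound v p with size , length ← Equivalence.to T-∧ p = ≡ᵇ⇒≡ _ _ size , ≡ᵇ⇒≡ _ _ length

unitVec : (n : ℕ) → Fin n → Vec ℕ n
unitVec (suc n) zero    = 1 ∷ replicate n 0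
unitVec (suc n) (suc j) = 0 ∷ unitVec n j

sizeFrom-replicate-0 : ∀ i n → sizeFrom i (replicate n 0) ≡ 0
sizeFrom-replicate-0 i zero    = refl
sizeFrom-replicate-0 i (suc n) = cong₂ _+_ (*-zeroʳ i) (sizeFrom-replicate-0 (suc i) n)

lengthP-replicate-0 : ∀ n → lengthP (replicate n 0) ≡ 0
lengthP-replicate-0 zero    = refl
lengthP-replicate-0 (suc n) = lengthP-replicate-0 n

sizeFrom-unitVec : ∀ i n (j : Fin n) → sizeFrom i (unitVec n j) ≡ i + toℕ j
sizeFrom-unitVec i (suc n) zero    = cong₂ _+_ (*-identityʳ i) (sizeFrom-replicate-0 (suc i) n)
sizeFrom-unitVec i (suc n) (suc j) =
  trans (cong₂ _+_ (*-zeroʳ i) (sizeFrom-unitVec (suc i) n j)) (sym (+-suc i (toℕ j)))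

lengthP-unitVec : ∀ n (j : Fin n) → lengthP (unitVec n j) ≡ 1
lengthP-unitVec (suc n) zero    = cong suc (lengthP-replicate-0 n)
lengthP-unitVec (suc n) (suc j) = lengthP-unitVec n j

addToHead : ℕ → Vec ℕ (suc n) → Vec ℕ (suc n)
addToHead a (m ∷ ms) = a + m ∷ ms

sizeFrom-addToHead : ∀ i a (v : Vec ℕ (suc n)) → sizeFrom i (addToHead a v) ≡ i * a + sizeFrom i v
sizeFrom-addToHead i a (m ∷ ms) = trans (cong (_+ sizeFrom (suc i) ms) (*-distribˡ-+ i a m)) (+-assoc (i * a) _ _)

lengthP-addToHead : ∀ a (v : Vec ℕ (suc n)) → lengthP (addToHead a v) ≡ a + lengthP v
lengthP-addToHead a (m ∷ ms) = +-assoc a m (lengthP ms)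

-- The partition 1^(t-1) (g-t+1)^1.
partition-exists : ∀ {g t} → 1 ≤ t → t ≤ g → ∃[ v ] IsPartition g t v
partition-exists {suc g} {suc t} _ (s≤s t≤g) = addToHead t (unitVec (suc g) j) , size , length
  where
  g∸t<1+g = s≤s (m∸n≤m g t)
  j = fromℕ< g∸t<1+g
  size : sizeFrom 1 (addToHead t (unitVec (suc g) j)) ≡ suc g
  size = begin
    sizeFrom 1 (addToHead t (unitVec (suc g) j))  ≡⟨ sizeFrom-addToHead 1 t (unitVec (suc g) j) ⟩
    1 * t + sizeFrom 1 (unitVec (suc g) j)        ≡⟨ cong₂ _+_ (*-identityˡ t) (sizeFrom-unitVec 1 (suc g) j) ⟩
    t + suc (toℕ j)                               ≡⟨ cong (λ k → t + suc k) (toℕ-fromℕ< g∸t<1+g) ⟩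
    t + suc (g ∸ t)                               ≡⟨ +-suc t (g ∸ t) ⟩
    suc (t + (g ∸ t))                             ≡⟨ cong suc (m+[n∸m]≡n t≤g) ⟩
    suc g                                         ∎
    where open ≡-Reasoning
  length : lengthP (addToHead t (unitVec (suc g) j)) ≡ suc t
  length = trans (lengthP-addToHead t (unitVec (suc g) j))
    (trans (cong (_+_ t) (lengthP-unitVec (suc g) j)) (+-comm t 1))

fromℕ : ℕ → ℚ
fromℕ n = + n / 1

fromℚᵘ-homo-* : ∀ p q → ℚ.fromℚᵘ (p ℚᵘ.* q) ≡ ℚ.fromℚᵘ p ℚ.* ℚ.fromℚᵘ q
fromℚᵘ-homo-* p q = toℚᵘ-injective (ℚᵘ.≃-trans (toℚᵘ-fromℚᵘ (p ℚᵘ.* q))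
  (ℚᵘ.≃-sym (ℚᵘ.≃-trans (toℚᵘ-homo-* (ℚ.fromℚᵘ p) (ℚ.fromℚᵘ q)) (ℚᵘ.*-cong (toℚᵘ-fromℚᵘ p) (toℚᵘ-fromℚᵘ q)))))

fromℚᵘ-homo-+ : ∀ p q → ℚ.fromℚᵘ (p ℚᵘ.+ q) ≡ ℚ.fromℚᵘ p ℚ.+ ℚ.fromℚᵘ q
fromℚᵘ-homo-+ p q = toℚᵘ-injective (ℚᵘ.≃-trans (toℚᵘ-fromℚᵘ (p ℚᵘ.+ q))
  (ℚᵘ.≃-sym (ℚᵘ.≃-trans (toℚᵘ-homo-+ (ℚ.fromℚᵘ p) (ℚ.fromℚᵘ q)) (ℚᵘ.+-cong (toℚᵘ-fromℚᵘ p) (toℚᵘ-fromℚᵘ q)))))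

/-*-/ : ∀ a b c d .{{_ : NonZero b}} .{{_ : NonZero d}} →
  (+ a / b) ℚ.* (+ c / d) ≡ (+ (a * c) / (b * d)) {{m*n≢0 b d}}
/-*-/ a (suc b) c (suc d) =
  trans (sym (fromℚᵘ-homo-* (mkℚᵘ (+ a) b) (mkℚᵘ (+ c) d))) (/-cong (sym (ℤ.pos-* a c)) refl)

*-/-cancelʳ : ∀ q d .{{_ : NonZero d}} → + (q * d) / d ≡ fromℕ q
*-/-cancelʳ q (suc d) = fromℚᵘ-cong {mkℚᵘ (+ (q * suc d)) d} {mkℚᵘ (+ q) 0}
  (*≡* (trans (ℤ.*-identityʳ _) (ℤ.pos-* q (suc d))))

fromℕ-+ : ∀ a b → fromℕ (a + b) ≡ fromℕ a ℚ.+ fromℕ b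
fromℕ-+ a b = trans (/-cong (trans (ℤ.pos-+ a b) (sym (cong₂ ℤ._+_ (ℤ.*-identityʳ (+ a)) (ℤ.*-identityʳ (+ b))))) refl)
  (fromℚᵘ-homo-+ (mkℚᵘ (+ a) 0) (mkℚᵘ (+ b) 0))

fromℕ-*-1/ : ∀ a d .{{_ : NonZero d}} → d ∣ a → fromℕ a ℚ.* (+ 1 / d) ≡ fromℕ (a ℕ./ d)
fromℕ-*-1/ a d d∣a = begin
  fromℕ a ℚ.* (+ 1 / d)                 ≡⟨ cong (λ x → fromℕ x ℚ.* (+ 1 / d)) (m/n*n≡m d∣a) ⟨
  fromℕ (a ℕ./ d * d) ℚ.* (+ 1 / d)     ≡⟨ /-*-/ (a ℕ./ d * d) 1 1 d ⟩
  (+ (a ℕ./ d * d * 1) / (1 * d)) {{m*n≢0 1 d}}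
                                        ≡⟨ /-cong {{m*n≢0 1 d}} (cong +_ (*-identityʳ (a ℕ./ d * d))) (*-identityˡ d) ⟩
  + (a ℕ./ d * d) / d                   ≡⟨ *-/-cancelʳ (a ℕ./ d) d ⟩
  fromℕ (a ℕ./ d)                       ∎
  where open ≡-Reasoning

1/b^ℚm≡1/b^m : ∀ b m .{{_ : NonZero b}} → (+ 1 / b) ^ℚ m ≡ (+ 1 / b ^ m) {{m^n≢0 b m}}
1/b^ℚm≡1/b^m b zero    = refl
1/b^ℚm≡1/b^m b (suc m) =
  trans (cong ((+ 1 / b) ℚ.*_) (1/b^ℚm≡1/b^m b m)) (/-*-/ 1 b 1 (b ^ m))
  where instance _ = m^n≢0 b m

weightFrom≡1/denominator : ∀ i (v : Vec ℕ n) → weightFrom i v ≡ (+ 1 / denominator i v) {{denominator≢0 i v}}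
weightFrom≡1/denominator i []       = refl
weightFrom≡1/denominator i (m ∷ ms) = begin
  (+ 1 / m !) ℚ.* (+ 1 / s) ^ℚ m ℚ.* weightFrom (suc i) ms
    ≡⟨ cong₂ (λ x y → (+ 1 / m !) ℚ.* x ℚ.* y) (1/b^ℚm≡1/b^m s m) (weightFrom≡1/denominator (suc i) ms) ⟩
  (+ 1 / m !) ℚ.* (+ 1 / s ^ m) ℚ.* (+ 1 / D)
    ≡⟨ cong (ℚ._* (+ 1 / D)) (/-*-/ 1 (m !) 1 (s ^ m)) ⟩
  (+ 1 / (m ! * s ^ m)) ℚ.* (+ 1 / D)
    ≡⟨ /-*-/ 1 (m ! * s ^ m) 1 D ⟩
  + 1 / (m ! * s ^ m * D)
    ∎
  where
  open ≡-Reasoning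
  s = suc (2 * i)
  D = denominator (suc i) ms
  instance
    _ = m !≢0
    _ = m^n≢0 s m
    _ = m*n≢0 (m !) (s ^ m)
    _ = denominator≢0 (suc i) ms
    _ = denominator≢0 i (m ∷ ms)

*-distribˡ-sumℚ : ∀ {A : Set} c (f : A → ℚ) xs → c ℚ.* sumℚ (map f xs) ≡ sumℚ (map (λ x → c ℚ.* f x) xs)
*-distribˡ-sumℚ c f []       = ℚ-*-zeroʳ c
*-distribˡ-sumℚ c f (x ∷ xs) =
  trans (ℚ-*-distribˡ-+ c (f x) (sumℚ (map f xs))) (cong (c ℚ.* f x ℚ.+_) (*-distribˡ-sumℚ c f xs))

sumℚ-fromℕ : ∀ {A : Set} (h : A → ℕ) xs → sumℚ (map (λ x → fromℕ (h x)) xs) ≡ fromℕ (sum (map h xs))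
sumℚ-fromℕ h []       = refl
sumℚ-fromℕ h (x ∷ xs) = trans (cong (fromℕ (h x) ℚ.+_) (sumℚ-fromℕ h xs)) (sym (fromℕ-+ (h x) _))

∈⇒≤sum : ∀ {m ms} → m ∈ ms → m ≤ sum ms
∈⇒≤sum {ms = m ∷ ms} (here refl) = m≤m+n m (sum ms)
∈⇒≤sum {ms = k ∷ ms} (there m∈ms) = ≤-trans (∈⇒≤sum m∈ms) (m≤n+m (sum ms) k)

κ-degree : ℕ → ℕ → ℕ
κ-degree g t = 2 * g + t ∸ 1

κ-numerator : ℕ → ℕ → ℕ
κ-numerator g t = 2 ^ (t ∸ 1) * oddProduct 0 (κ-degree g t)

κ-numerator≢0 : ∀ g t → NonZero (κ-numerator g t)
κ-numerator≢0 g t = m*n≢0 (2 ^ (t ∸ 1)) _ {{m^n≢0 2 (t ∸ 1)}} {{oddProduct≢0 0 (κ-degree g t)}}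

κ-coefficient : (g t : ℕ) → Vec ℕ g → ℕ
κ-coefficient g t v = (κ-numerator g t ℕ./ denominator 1 v) {{denominator≢0 1 v}}

2^κ-degree : ∀ g t → 1 ≤ t → 2 ^ κ-degree g t ≡ 4 ^ g * 2 ^ (t ∸ 1)
2^κ-degree g t 1≤t = begin
  2 ^ (2 * g + t ∸ 1)         ≡⟨ cong (2 ^_) (+-∸-assoc (2 * g) 1≤t) ⟩
  2 ^ (2 * g + (t ∸ 1))       ≡⟨ ^-distribˡ-+-* 2 (2 * g) (t ∸ 1) ⟩
  2 ^ (2 * g) * 2 ^ (t ∸ 1)   ≡⟨ cong (_* 2 ^ (t ∸ 1)) (^-*-assoc 2 2 g) ⟨
  4 ^ g * 2 ^ (t ∸ 1)         ∎
  where open ≡-Reasoning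

κ-prefactor≡κ-numerator : ∀ g t → 1 ≤ t → let N = κ-degree g t in
  (+ ((2 * N) !) / N !) {{N !≢0}} ℚ.* (+ 1 / 4) ^ℚ g ≡ fromℕ (κ-numerator g t)
κ-prefactor≡κ-numerator g t 1≤t = begin
  (+ ((2 * N) !) / N !) ℚ.* (+ 1 / 4) ^ℚ g       ≡⟨ cong ((+ ((2 * N) !) / N !) ℚ.*_) (1/b^ℚm≡1/b^m 4 g) ⟩
  (+ ((2 * N) !) / N !) ℚ.* (+ 1 / 4 ^ g)        ≡⟨ /-*-/ ((2 * N) !) (N !) 1 (4 ^ g) ⟩
  + ((2 * N) ! * 1) / (N ! * 4 ^ g)            ≡⟨ /-cong (cong +_ factorisation) refl ⟩
  + (A * (N ! * 4 ^ g)) / (N ! * 4 ^ g)        ≡⟨ *-/-cancelʳ A (N ! * 4 ^ g) ⟩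
  fromℕ A                                      ∎
  where
  open ≡-Reasoning
  N = κ-degree g t
  A = κ-numerator g t
  P = oddProduct 0 N
  instance
    _ = N !≢0
    _ = m^n≢0 4 g
    _ = m*n≢0 (N !) (4 ^ g)
  regroup : ∀ f q p o → f * (q * p * o) ≡ p * o * (f * q)
  regroup = solve-∀
  factorisation : (2 * N) ! * 1 ≡ A * (N ! * 4 ^ g)
  factorisation = begin
    (2 * N) ! * 1                       ≡⟨ *-identityʳ ((2 * N) !) ⟩
    (2 * N) !                           ≡⟨ [2m]!≡m!*2^m*oddProduct N ⟩
    N ! * (2 ^ N * P)                   ≡⟨ cong (λ x → N ! * (x * P)) (2^κ-degree g t 1≤t) ⟩
    N ! * (4 ^ g * 2 ^ (t ∸ 1) * P)     ≡⟨ regroup (N !) (4 ^ g) (2 ^ (t ∸ 1)) P ⟩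
    A * (N ! * 4 ^ g)                   ∎

denominator∣κ-numerator : ∀ {g t} → 1 ≤ t → (v : Vec ℕ g) → IsPartition g t v → denominator 1 v ∣ κ-numerator g t
denominator∣κ-numerator {g} {t} 1≤t v (size≡g , length≡t) =
  subst (denominator 1 v ∣_) numerator≡ (denominator-∣-initial 1 ≤-refl v (subst (1 ≤_) (sym length≡t) 1≤t))
  where
  numerator≡ : 2 ^ (lengthP v ∸ 1) * oddProduct 0 (oddSize 1 v ∸ 1) ≡ κ-numerator g t
  numerator≡ = cong₂ (λ ℓ o → 2 ^ (ℓ ∸ 1) * oddProduct 0 (o ∸ 1)) length≡t
    (trans (oddSize≡2*sizeFrom+lengthP 1 v) (cong₂ (λ s ℓ → 2 * s + ℓ) size≡g length≡t))

κ-coefficient-positive : ∀ {g t} → 1 ≤ t → (v : Vec ℕ g) → IsPartition g t v → 1 ≤ κ-coefficient g t v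
κ-coefficient-positive {g} {t} 1≤t v partition = m≥n⇒m/n>0 (∣⇒≤ (denominator∣κ-numerator 1≤t v partition))
  where instance
  _ = denominator≢0 1 v
  _ = κ-numerator≢0 g t

κ≡sum-κ-coefficient : ∀ g t → 1 ≤ t → κ g t ≡ fromℕ (sum (map (κ-coefficient g t) (partitionsWithParts g t)))
κ≡sum-κ-coefficient g t 1≤t = begin
  κ g t
    ≡⟨ cong (ℚ._* sumℚ (map (weightFrom 1) L)) (κ-prefactor≡κ-numerator g t 1≤t) ⟩
  fromℕ A ℚ.* sumℚ (map (weightFrom 1) L)
    ≡⟨ *-distribˡ-sumℚ (fromℕ A) (weightFrom 1) L ⟩
  sumℚ (map (λ v → fromℕ A ℚ.* weightFrom 1 v) L)
    ≡⟨ cong sumℚ (map-cong-local (List.map (λ {v} → summand v) (partitionsWithParts-sound g t))) ⟩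
  sumℚ (map (λ v → fromℕ (κ-coefficient g t v)) L)
    ≡⟨ sumℚ-fromℕ (κ-coefficient g t) L ⟩
  fromℕ (sum (map (κ-coefficient g t) L))
    ∎
  where
  open ≡-Reasoning
  L = partitionsWithParts g t
  A = κ-numerator g t
  summand : ∀ v → IsPartition g t v → fromℕ A ℚ.* weightFrom 1 v ≡ fromℕ (κ-coefficient g t v)
  summand v partition = trans (cong (fromℕ A ℚ.*_) (weightFrom≡1/denominator 1 v))
    (fromℕ-*-1/ A (denominator 1 v) {{denominator≢0 1 v}} (denominator∣κ-numerator 1≤t v partition))

corollary2 : ∀ (g t : ℕ) → 1 ≤ g → 1 ≤ t → t ≤ g → ∃[ n ] (1 ≤ n × κ g t ≡ + n / 1)
corollary2 g t _ 1≤t t≤g = sum (map (κ-coefficient g t) L) , 1≤sum , κ≡sum-κ-coefficient g t 1≤t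
  where
  L = partitionsWithParts g t
  1≤sum : 1 ≤ sum (map (κ-coefficient g t) L)
  1≤sum with v , partition ← partition-exists 1≤t t≤g =
    ≤-trans (κ-coefficient-positive 1≤t v partition)
            (∈⇒≤sum (∈-map⁺ (κ-coefficient g t) (∈-partitionsWithParts⁺ v partition)))
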